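{- Let $A$ be any set and let $\mathcal{I}$ be an ideal containing a set $S$. If $U_{A,S}=\{p_S(\ulcorner A\upharpoonright i\urcorner): i\in\omega\}$ has an infinite subset in $\mathcal{I}$, then $A\in\mathcal{I}$.
   Context: Sets are subsets of $\omega$. A (Turing) ideal is a collection of sets closed under $\le_T$ and $\oplus$. $p_S$ is the principal function of $S$ ($p_S(n)$ is the $n$-th element of $S$ in increasing order, defined when $S$ has more than $n$ elements), $A\upharpoonright i=A\cap\{0,\dots,i-1\}$, and $\ulcorner F\urcorner$ is the canonical index of the finite set $F$. -}

module Defs where

open import Data.Nat using (ℕ; zero; suc; _+_; _^_; _<_; _≤_)
open import Data.Bool using (Bool; true; false; if_then_else_)
open import Data.Fin using (Fin)
open import Data.Vec using (Vec; []; _∷_; lookup)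
open import Data.Product using (Σ; ∃; _×_; _,_)
open import Relation.Binary.PropositionalEquality using (_≡_; _≢_)
open import Relation.Unary using (Pred)
open import Level using (0ℓ)

SetN : Set
SetN = ℕ → Bool

χ : Bool → ℕ
χ true  = 1
χ false = 0

data PR : ℕ → Set where
  Z    : ∀ {n} → PR n
  Sc   : PR 1
  P    : ∀ {n} → Fin n → PR n
  O    : PR 1
  Comp : ∀ {m n} → PR m → Vec (PR n) m → PR n
  Rec  : ∀ {n} → PR n → PR (suc (suc n)) → PR (suc n)
  Mu   : ∀ {n} → PR (suc n) → PR n

mutual
  data Eval (X : SetN) : ∀ {n} → PR n → Vec ℕ n → ℕ → Set where
    evZ    : ∀ {n} {xs : Vec ℕ n} → Eval X Z xs 0
    evS    : ∀ {x} → Eval X Sc (x ∷ []) (suc x)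
    evP    : ∀ {n} {i : Fin n} {xs} → Eval X (P i) xs (lookup xs i)
    evO    : ∀ {x} → Eval X O (x ∷ []) (χ (X x))
    evComp : ∀ {m n} {f : PR m} {gs : Vec (PR n) m} {xs ys y} →
             Evals X gs xs ys → Eval X f ys y → Eval X (Comp f gs) xs y
    evRec0 : ∀ {n} {g : PR n} {h : PR (suc (suc n))} {xs y} →
             Eval X g xs y → Eval X (Rec g h) (0 ∷ xs) y
    evRecS : ∀ {n} {g : PR n} {h : PR (suc (suc n))} {x xs r y} →
             Eval X (Rec g h) (x ∷ xs) r → Eval X h (x ∷ r ∷ xs) y →
             Eval X (Rec g h) (suc x ∷ xs) y
    evMu   : ∀ {n} {f : PR (suc n)} {xs y} →
             Eval X f (y ∷ xs) 0 →
             (∀ z → z < y → Σ ℕ λ k → Eval X f (z ∷ xs) (suc k)) →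
             Eval X (Mu f) xs y

  data Evals (X : SetN) {n : ℕ} : ∀ {m} → Vec (PR n) m → Vec ℕ n → Vec ℕ m → Set where
    []  : ∀ {xs} → Evals X [] xs []
    _∷_ : ∀ {m g y} {gs : Vec (PR n) m} {xs ys} →
          Eval X g xs y → Evals X gs xs ys → Evals X (g ∷ gs) xs (y ∷ ys)

_≤T_ : SetN → SetN → Set
Y ≤T X = Σ (PR 1) λ e → ∀ n → Eval X e (n ∷ []) (χ (Y n))

-- Effective join X ⊕ Y = {2n : n ∈ X} ∪ {2n+1 : n ∈ Y}.
_⊕_ : SetN → SetN → SetN
(X ⊕ Y) zero = X 0
(X ⊕ Y) (suc zero) = Y 0
(X ⊕ Y) (suc (suc n)) = ((λ k → X (suc k)) ⊕ (λ k → Y (suc k))) n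

record IsIdeal (I : Pred SetN 0ℓ) : Set₁ where
  field
    downward : ∀ {X Y} → I X → Y ≤T X → I Y
    join     : ∀ {X Y} → I X → I Y → I (X ⊕ Y)

countBelow : SetN → ℕ → ℕ
countBelow S zero = 0
countBelow S (suc x) = countBelow S x + χ (S x)

-- p_S(n) ≡ x : x is the n-th element (0-indexed) of S in increasing order
IsPrincipal : SetN → ℕ → ℕ → Set
IsPrincipal S n x = (S x ≡ true) × (countBelow S x ≡ n)

codeRestr : SetN → ℕ → ℕ
codeRestr A zero = 0
codeRestr A (suc i) = codeRestr A i + (if A i then 2 ^ i else 0)

-- U_{A,S} = { p_S(⌜A↾i⌝) : i ∈ ω }  (over those i where p_S is defined)
InU : SetN → SetN → ℕ → Set
InU A S x = ∃ λ i → IsPrincipal S (codeRestr A i) x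

Infinite : SetN → Set
Infinite B = ∀ n → ∃ λ m → (n ≤ m) × (B m ≡ true)

_⊆U[_,_] : SetN → SetN → SetN → Set
B ⊆U[ A , S ] = ∀ x → B x ≡ true → InU A S x

-- To decide n ∈ A with oracle B ⊕ S, search for some y ∈ B with |S ↾ y| ≥ 2^(n+1).
-- As y ∈ U_{A,S}, y = p_S(⌜A ↾ i⌝) for some i, so |S ↾ y| = ⌜A ↾ i⌝; that code is
-- at least 2^(n+1) only if i > n, and then bit n of |S ↾ y| is A(n). Such a y exists
-- because B is an infinite subset of S.
module Submission where

open import Defs
open import Relation.Unary using (Pred)
open import Level using (0ℓ)
open import Data.Product using (Σ; _×_; _,_; ∃-syntax)
open import Data.Nat using (ℕ; zero; suc; _+_; _*_; _∸_; _^_; _<_; _≤_; _≤′_; ≤′-refl; ≤′-step; z≤n; s≤s)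
open import Data.Nat.Properties
open import Data.Nat.Solver using (module +-*-Solver)
open import Data.Bool using (true; false; if_then_else_)
open import Data.Fin using () renaming (zero to fz; suc to fs)
open import Data.Vec using ([]; _∷_)
open import Function using (_∘_)
open import Relation.Binary.PropositionalEquality
open +-*-Solver

oneᴾ : ∀ {n} → PR n
oneᴾ = Comp Sc (Z ∷ [])

oneᴾ-eval : ∀ {X n} {xs} → Eval X (oneᴾ {n}) xs 1
oneᴾ-eval = evComp (evZ ∷ []) evS

addᴾ : PR 2
addᴾ = Rec (P fz) (Comp Sc (P (fs fz) ∷ []))

addᴾ-eval : ∀ {X} x y → Eval X addᴾ (x ∷ y ∷ []) (x + y)
addᴾ-eval zero    y = evRec0 evP
addᴾ-eval (suc x) y = evRecS (addᴾ-eval x y) (evComp (evP ∷ []) evS)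

predᴾ : PR 1
predᴾ = Rec Z (P fz)

predᴾ-eval : ∀ {X} x → Eval X predᴾ (x ∷ []) (x ∸ 1)
predᴾ-eval zero    = evRec0 evZ
predᴾ-eval (suc x) = evRecS (predᴾ-eval x) evP

monusᴾ : PR 2
monusᴾ = Rec (P fz) (Comp predᴾ (P (fs fz) ∷ []))

monusᴾ-eval : ∀ {X} y x → Eval X monusᴾ (y ∷ x ∷ []) (x ∸ y)
monusᴾ-eval zero    x = evRec0 evP
monusᴾ-eval {X} (suc y) x =
  subst (Eval X monusᴾ (suc y ∷ x ∷ [])) (trans (∸-+-assoc x y 1) (cong (x ∸_) (+-comm y 1)))
    (evRecS (monusᴾ-eval y x) (evComp (evP ∷ []) (predᴾ-eval (x ∸ y))))

mulᴾ : PR 2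
mulᴾ = Rec Z (Comp addᴾ (P (fs (fs fz)) ∷ P (fs fz) ∷ []))

mulᴾ-eval : ∀ {X} x y → Eval X mulᴾ (x ∷ y ∷ []) (x * y)
mulᴾ-eval zero    y = evRec0 evZ
mulᴾ-eval (suc x) y = evRecS (mulᴾ-eval x y) (evComp (evP ∷ evP ∷ []) (addᴾ-eval y (x * y)))

pow₂ᴾ : PR 1
pow₂ᴾ = Rec oneᴾ (Comp addᴾ (P (fs fz) ∷ P (fs fz) ∷ []))

pow₂ᴾ-eval : ∀ {X} n → Eval X pow₂ᴾ (n ∷ []) (2 ^ n)
pow₂ᴾ-eval zero = evRec0 oneᴾ-eval
pow₂ᴾ-eval {X} (suc n) =
  subst (Eval X pow₂ᴾ (suc n ∷ [])) (cong (2 ^ n +_) (sym (+-identityʳ (2 ^ n))))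
    (evRecS (pow₂ᴾ-eval n) (evComp (evP ∷ evP ∷ []) (addᴾ-eval (2 ^ n) (2 ^ n))))

double : ℕ → ℕ
double zero    = zero
double (suc x) = suc (suc (double x))

doubleᴾ : PR 1
doubleᴾ = Rec Z (Comp Sc (Comp Sc (P (fs fz) ∷ []) ∷ []))

doubleᴾ-eval : ∀ {X} x → Eval X doubleᴾ (x ∷ []) (double x)
doubleᴾ-eval zero    = evRec0 evZ
doubleᴾ-eval (suc x) = evRecS (doubleᴾ-eval x) (evComp (evComp (evP ∷ []) evS ∷ []) evS)

parity : ℕ → ℕ
parity zero    = 0
parity (suc x) = 1 ∸ parity x

parityᴾ : PR 1
parityᴾ = Rec Z (Comp monusᴾ (P (fs fz) ∷ oneᴾ ∷ []))

parityᴾ-eval : ∀ {X} x → Eval X parityᴾ (x ∷ []) (parity x)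
parityᴾ-eval zero    = evRec0 evZ
parityᴾ-eval (suc x) =
  evRecS (parityᴾ-eval x) (evComp (evP ∷ oneᴾ-eval ∷ []) (monusᴾ-eval (parity x) 1))

parity-2+ : ∀ x → parity (2 + x) ≡ parity x
parity-2+ zero    = refl
parity-2+ (suc x) = cong (1 ∸_) (parity-2+ x)

parity-*2+χ : ∀ r b → parity (r * 2 + χ b) ≡ χ b
parity-*2+χ zero    true  = refl
parity-*2+χ zero    false = refl
parity-*2+χ (suc r) b     = trans (parity-2+ (r * 2 + χ b)) (parity-*2+χ r b)

least-zero : (G : ℕ → ℕ) (b : ℕ) → G b ≡ 0 →
  ∃[ y ] G y ≡ 0 × (∀ z → z < y → ∃[ k ] G z ≡ suc k)
least-zero G zero    Gb≡0 = 0 , Gb≡0 , λ _ ()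
least-zero G (suc b) Gb≡0 with G 0 in G0≡
... | zero  = 0 , G0≡ , λ _ ()
... | suc k with least-zero (G ∘ suc) b Gb≡0
...   | y , Gy≡0 , below = suc y , Gy≡0 , λ where
          zero    _         → k , G0≡
          (suc z) (s≤s z<y) → below z z<y

eval-Mu-least : ∀ {X n} {f : PR (suc n)} {xs} (G : ℕ → ℕ) →
  (∀ z → Eval X f (z ∷ xs) (G z)) →
  ∀ {y} → G y ≡ 0 → (∀ z → z < y → ∃[ k ] G z ≡ suc k) → Eval X (Mu f) xs y
eval-Mu-least {X} {f = f} {xs} G f-eval {y} Gy≡0 below =
  evMu (subst (Eval X f (y ∷ xs)) Gy≡0 (f-eval y))
       (λ z z<y → let k , Gz≡ = below z z<y in k , subst (Eval X f (z ∷ xs)) Gz≡ (f-eval z))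

eval-Mu : ∀ {X n} {f : PR (suc n)} {xs} (G : ℕ → ℕ) →
  (∀ z → Eval X f (z ∷ xs) (G z)) →
  ∀ b → G b ≡ 0 → ∃[ y ] G y ≡ 0 × Eval X (Mu f) xs y
eval-Mu G f-eval b Gb≡0 =
  let y , Gy≡0 , below = least-zero G b Gb≡0 in y , Gy≡0 , eval-Mu-least G f-eval Gy≡0 below

-- ⌊c / d⌋ is the least m with c < d * (m + 1).
quot-testᴾ : PR 3
quot-testᴾ = Comp monusᴾ (Comp mulᴾ (P (fs fz) ∷ Comp Sc (P fz ∷ []) ∷ []) ∷
                         Comp Sc (P (fs (fs fz)) ∷ []) ∷ [])

quot-testᴾ-eval : ∀ {X} m d c → Eval X quot-testᴾ (m ∷ d ∷ c ∷ []) (suc c ∸ d * suc m)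
quot-testᴾ-eval m d c =
  evComp (evComp (evP ∷ evComp (evP ∷ []) evS ∷ []) (mulᴾ-eval d (suc m)) ∷
          evComp (evP ∷ []) evS ∷ []) (monusᴾ-eval (d * suc m) (suc c))

quotᴾ : PR 2
quotᴾ = Mu quot-testᴾ

quotᴾ-eval : ∀ {X} d c q m → q < d → c ≡ q + d * m → Eval X quotᴾ (d ∷ c ∷ []) m
quotᴾ-eval d c q m q<d c≡ =
  eval-Mu-least (λ z → suc c ∸ d * suc z) (λ z → quot-testᴾ-eval z d c)
    (m≤n⇒m∸n≡0 c<d*[1+m])
    (λ z z<m → c ∸ d * suc z , +-∸-assoc 1 (≤-trans (*-monoʳ-≤ d z<m) d*m≤c))
  where
  c<d*[1+m] : suc c ≤ d * suc m
  c<d*[1+m] = subst₂ _≤_ (cong suc (sym c≡)) (sym (*-suc d m)) (+-monoˡ-≤ (d * m) q<d)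
  d*m≤c : d * m ≤ c
  d*m≤c = subst (d * m ≤_) (sym c≡) (m≤n+m (d * m) q)

⊕-double : ∀ (Y W : SetN) x → (Y ⊕ W) (double x) ≡ Y x
⊕-double Y W zero    = refl
⊕-double Y W (suc x) = ⊕-double (Y ∘ suc) (W ∘ suc) x

⊕-suc-double : ∀ (Y W : SetN) x → (Y ⊕ W) (suc (double x)) ≡ W x
⊕-suc-double Y W zero    = refl
⊕-suc-double Y W (suc x) = ⊕-suc-double (Y ∘ suc) (W ∘ suc) x

leftᴾ : PR 1
leftᴾ = Comp O (Comp doubleᴾ (P fz ∷ []) ∷ [])

leftᴾ-eval : ∀ {Y W} x → Eval (Y ⊕ W) leftᴾ (x ∷ []) (χ (Y x))
leftᴾ-eval {Y} {W} x = subst (Eval (Y ⊕ W) leftᴾ (x ∷ [])) (cong χ (⊕-double Y W x))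
  (evComp (evComp (evP ∷ []) (doubleᴾ-eval x) ∷ []) evO)

rightᴾ : PR 1
rightᴾ = Comp O (Comp Sc (Comp doubleᴾ (P fz ∷ []) ∷ []) ∷ [])

rightᴾ-eval : ∀ {Y W} x → Eval (Y ⊕ W) rightᴾ (x ∷ []) (χ (W x))
rightᴾ-eval {Y} {W} x = subst (Eval (Y ⊕ W) rightᴾ (x ∷ [])) (cong χ (⊕-suc-double Y W x))
  (evComp (evComp (evComp (evP ∷ []) (doubleᴾ-eval x) ∷ []) evS ∷ []) evO)

countʳᴾ : PR 1
countʳᴾ = Rec Z (Comp addᴾ (P (fs fz) ∷ Comp rightᴾ (P fz ∷ []) ∷ []))

countʳᴾ-eval : ∀ {Y W} x → Eval (Y ⊕ W) countʳᴾ (x ∷ []) (countBelow W x)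
countʳᴾ-eval zero    = evRec0 evZ
countʳᴾ-eval {W = W} (suc x) = evRecS (countʳᴾ-eval x)
  (evComp (evP ∷ evComp (evP ∷ []) (rightᴾ-eval x) ∷ []) (addᴾ-eval (countBelow W x) (χ (W x))))

shortfall : SetN → SetN → ℕ → ℕ → ℕ
shortfall Y W n x = (1 ∸ χ (Y x)) + (2 ^ suc n ∸ countBelow W x)

shortfallᴾ : PR 2
shortfallᴾ = Comp addᴾ (Comp monusᴾ (Comp leftᴾ (P fz ∷ []) ∷ oneᴾ ∷ []) ∷
                        Comp monusᴾ (Comp countʳᴾ (P fz ∷ []) ∷ Comp pow₂ᴾ (Comp Sc (P (fs fz) ∷ []) ∷ []) ∷ []) ∷ [])

shortfallᴾ-eval : ∀ {Y W} x n → Eval (Y ⊕ W) shortfallᴾ (x ∷ n ∷ []) (shortfall Y W n x)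
shortfallᴾ-eval {Y} {W} x n = evComp
  (evComp (evComp (evP ∷ []) (leftᴾ-eval x) ∷ oneᴾ-eval ∷ []) (monusᴾ-eval (χ (Y x)) 1) ∷
   evComp (evComp (evP ∷ []) (countʳᴾ-eval x) ∷ evComp (evComp (evP ∷ []) evS ∷ []) (pow₂ᴾ-eval (suc n)) ∷ [])
     (monusᴾ-eval (countBelow W x) (2 ^ suc n)) ∷ [])
  (addᴾ-eval (1 ∸ χ (Y x)) (2 ^ suc n ∸ countBelow W x))

shortfall≡0 : ∀ Y W n x → Y x ≡ true → 2 ^ suc n ≤ countBelow W x → shortfall Y W n x ≡ 0
shortfall≡0 _ _ _ _ Yx bound rewrite Yx = m≤n⇒m∸n≡0 bound

shortfall≡0⇒ : ∀ Y W n x → shortfall Y W n x ≡ 0 → Y x ≡ true × 2 ^ suc n ≤ countBelow W x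
shortfall≡0⇒ Y _ _ x ≡0 with Y x
... | true  = refl , m∸n≡0⇒m≤n ≡0
... | false with () ← ≡0

countBelow-mono : ∀ S {x y} → x ≤ y → countBelow S x ≤ countBelow S y
countBelow-mono S = mono′ ∘ ≤⇒≤′
  where
  mono′ : ∀ {x y} → x ≤′ y → countBelow S x ≤ countBelow S y
  mono′ ≤′-refl        = ≤-refl
  mono′ (≤′-step x≤′y) = ≤-trans (mono′ x≤′y) (m≤m+n _ _)

countBelow-suc-∈ : ∀ S {x} → S x ≡ true → countBelow S (suc x) ≡ suc (countBelow S x)
countBelow-suc-∈ S {x} Sx rewrite Sx = +-comm (countBelow S x) 1

countBelow-unbounded : ∀ {B S} → Infinite B → (∀ x → B x ≡ true → S x ≡ true) →
  ∀ K → ∃[ x ] B x ≡ true × K ≤ countBelow S x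
countBelow-unbounded B-inf B⊆S zero =
  let x , _ , Bx = B-inf 0 in x , Bx , z≤n
countBelow-unbounded {S = S} B-inf B⊆S (suc K) =
  let x , Bx , K≤ = countBelow-unbounded B-inf B⊆S K
      x′ , x<x′ , Bx′ = B-inf (suc x)
  in x′ , Bx′ , ≤-trans (subst (suc K ≤_) (sym (countBelow-suc-∈ S (B⊆S x Bx))) (s≤s K≤))
                        (countBelow-mono S x<x′)

codeRestr<2^ : ∀ A i → codeRestr A i < 2 ^ i
codeRestr<2^ A zero    = s≤s z≤n
codeRestr<2^ A (suc i) = subst (codeRestr A (suc i) <_) (cong (2 ^ i +_) (sym (+-identityʳ (2 ^ i))))
  (+-mono-<-≤ (codeRestr<2^ A i) (digit≤ (A i)))
  where
  digit≤ : ∀ b → (if b then 2 ^ i else 0) ≤ 2 ^ i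
  digit≤ true  = ≤-refl
  digit≤ false = z≤n

if-2^ : ∀ n b → (if b then 2 ^ n else 0) ≡ 2 ^ n * χ b
if-2^ n true  = sym (*-identityʳ (2 ^ n))
if-2^ n false = sym (*-zeroʳ (2 ^ n))

codeRestr-extend : ∀ A j d → ∃[ r ] codeRestr A (d + j) ≡ codeRestr A j + 2 ^ j * r
codeRestr-extend A j zero = 0 , sym (trans (cong (codeRestr A j +_) (*-zeroʳ (2 ^ j))) (+-identityʳ _))
codeRestr-extend A j (suc d) =
  let r , eq = codeRestr-extend A j d in
  r + 2 ^ d * χ (A (d + j)) , (begin
    codeRestr A (d + j) + (if A (d + j) then 2 ^ (d + j) else 0)
      ≡⟨ cong₂ _+_ eq (if-2^ (d + j) (A (d + j))) ⟩
    codeRestr A j + 2 ^ j * r + 2 ^ (d + j) * χ (A (d + j))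
      ≡⟨ cong (λ t → codeRestr A j + 2 ^ j * r + t * χ (A (d + j))) (trans (^-distribˡ-+-* 2 d j) (*-comm (2 ^ d) (2 ^ j))) ⟩
    codeRestr A j + 2 ^ j * r + 2 ^ j * 2 ^ d * χ (A (d + j))
      ≡⟨ solve 5 (λ c p r q b → c :+ p :* r :+ p :* q :* b := c :+ p :* (r :+ q :* b)) refl
           (codeRestr A j) (2 ^ j) r (2 ^ d) (χ (A (d + j))) ⟩
    codeRestr A j + 2 ^ j * (r + 2 ^ d * χ (A (d + j))) ∎)
  where open ≡-Reasoning

-- The bound forces i > n, because ⌜A ↾ i⌝ < 2^i.
codeRestr-digit : ∀ A n i → 2 ^ suc n ≤ codeRestr A i →
  ∃[ r ] codeRestr A i ≡ codeRestr A n + 2 ^ n * (r * 2 + χ (A n))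
codeRestr-digit A n i bound =
  let r , eq = codeRestr-extend A (suc n) (i ∸ suc n) in
  r , (begin
    codeRestr A i
      ≡⟨ cong (codeRestr A) (sym (m∸n+n≡m n<i)) ⟩
    codeRestr A (i ∸ suc n + suc n)
      ≡⟨ eq ⟩
    codeRestr A n + (if A n then 2 ^ n else 0) + 2 * 2 ^ n * r
      ≡⟨ cong (λ t → codeRestr A n + t + 2 * 2 ^ n * r) (if-2^ n (A n)) ⟩
    codeRestr A n + 2 ^ n * χ (A n) + 2 * 2 ^ n * r
      ≡⟨ solve 4 (λ c p b r → c :+ p :* b :+ con 2 :* p :* r := c :+ p :* (r :* con 2 :+ b)) refl
           (codeRestr A n) (2 ^ n) (χ (A n)) r ⟩
    codeRestr A n + 2 ^ n * (r * 2 + χ (A n)) ∎)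
  where
  open ≡-Reasoning
  n<i : suc n ≤ i
  n<i = ≮⇒≥ λ i<1+n → <⇒≱ (<-≤-trans (codeRestr<2^ A i) (^-monoʳ-≤ 2 (<⇒≤ i<1+n))) bound

⊆U⇒⊆ : ∀ {A S B} → B ⊆U[ A , S ] → ∀ x → B x ≡ true → S x ≡ true
⊆U⇒⊆ B⊆U x Bx = let _ , Sx , _ = B⊆U x Bx in Sx

-- On input n: find the least y ∈ B with |S ↾ y| ≥ 2^(n+1), then take bit n of |S ↾ y|.
decideᴾ : PR 1
decideᴾ = Comp parityᴾ (Comp quotᴾ (Comp pow₂ᴾ (P fz ∷ []) ∷ Comp countʳᴾ (Mu shortfallᴾ ∷ []) ∷ []) ∷ [])

decideᴾ-eval-digit : ∀ {Y W} n y q m → Eval (Y ⊕ W) (Mu shortfallᴾ) (n ∷ []) y →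
  q < 2 ^ n → countBelow W y ≡ q + 2 ^ n * m → Eval (Y ⊕ W) decideᴾ (n ∷ []) (parity m)
decideᴾ-eval-digit {W = W} n y q m search q<2^n count≡ =
  evComp (evComp (evComp (evP ∷ []) (pow₂ᴾ-eval n) ∷ evComp (search ∷ []) (countʳᴾ-eval y) ∷ [])
                 (quotᴾ-eval (2 ^ n) (countBelow W y) q m q<2^n count≡) ∷ [])
         (parityᴾ-eval m)

decideᴾ-eval : ∀ A S B → Infinite B → B ⊆U[ A , S ] → ∀ n → Eval (B ⊕ S) decideᴾ (n ∷ []) (χ (A n))
decideᴾ-eval A S B B-inf B⊆U n =
  let x , Bx , x-big = countBelow-unbounded B-inf (⊆U⇒⊆ B⊆U) (2 ^ suc n)
      y , y-short , search =
        eval-Mu (shortfall B S n) (λ z → shortfallᴾ-eval z n) x (shortfall≡0 B S n x Bx x-big)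
      By , y-big = shortfall≡0⇒ B S n y y-short
      i , _ , count≡code = B⊆U y By
      r , code≡ = codeRestr-digit A n i (subst (2 ^ suc n ≤_) count≡code y-big)
  in subst (Eval (B ⊕ S) decideᴾ (n ∷ [])) (parity-*2+χ r (A n))
       (decideᴾ-eval-digit n y (codeRestr A n) (r * 2 + χ (A n)) search
          (codeRestr<2^ A n) (trans count≡code code≡))

lemma5p1 : (A S : SetN) (I : Pred SetN 0ℓ) → IsIdeal I → I S →
    Σ SetN (λ B → I B × Infinite B × B ⊆U[ A , S ]) → I A
lemma5p1 A S I ideal IS (B , IB , B-inf , B⊆U) =
  IsIdeal.downward ideal (IsIdeal.join ideal IB IS) (decideᴾ , decideᴾ-eval A S B B-inf B⊆U)
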